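{- Let $\mathbf{C}$ be a hyperextensive category. Then $\mathbf{C}$ has unions of $\omega$-chains of summands; such unions are again summands, and they are universal, i.e. stable under pullbacks.
   Context: A category is hyperextensive if (1) it has countable coproducts that are disjoint (the pullback of two distinct coproduct injections is initial) and universal (stable under pullback), and (2) subobjects that are coproduct injections are closed under countable disjoint unions: given countably many pairwise disjoint subobjects $A_i\to B$ that are coproduct injections, their union $\sum_i A_i\to B$ is again a coproduct injection. A summand is a subobject whose inclusion is a binary coproduct injection. -}

module Defs where

open import Level using (Level; _⊔_; suc)
open import Data.Nat using (ℕ)
open import Data.Fin using (Fin)
open import Data.Product using (Σ; _×_; _,_; ∃-syntax)
open import Relation.Binary using (Rel; IsEquivalence)
open import Relation.Binary.PropositionalEquality using (_≢_)

record Category (o ℓ e : Level) : Set (Level.suc (o ⊔ ℓ ⊔ e)) where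
  infixr 9 _∘_
  infix  4 _≈_
  field
    Obj   : Set o
    Hom   : Obj → Obj → Set ℓ
    _≈_   : ∀ {A B} → Rel (Hom A B) e
    id    : ∀ {A} → Hom A A
    _∘_   : ∀ {A B C} → Hom B C → Hom A B → Hom A C
    ≈-equiv : ∀ {A B} → IsEquivalence (_≈_ {A} {B})
    ∘-resp-≈ : ∀ {A B C} {f f' : Hom B C} {g g' : Hom A B} →
               f ≈ f' → g ≈ g' → f ∘ g ≈ f' ∘ g'
    assoc : ∀ {A B C D} (f : Hom C D) (g : Hom B C) (h : Hom A B) →
            (f ∘ g) ∘ h ≈ f ∘ (g ∘ h)
    identityˡ : ∀ {A B} (f : Hom A B) → id ∘ f ≈ f
    identityʳ : ∀ {A B} (f : Hom A B) → f ∘ id ≈ f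

-- Countable index sets: the finite sets Fin n and ℕ

data CIdx : Set where
  fin   : ℕ → CIdx
  omega : CIdx

⟦_⟧ : CIdx → Set
⟦ fin n ⟧ = Fin n
⟦ omega ⟧ = ℕ

module _ {o ℓ e} (𝒞 : Category o ℓ e) where
  open Category 𝒞

  Mono : ∀ {A B} → Hom A B → Set (o ⊔ ℓ ⊔ e)
  Mono {A} f = ∀ {Z} (g h : Hom Z A) → f ∘ g ≈ f ∘ h → g ≈ h

  IsInitial : Obj → Set (o ⊔ ℓ ⊔ e)
  IsInitial X = ∀ Z → Σ (Hom X Z) λ h → ∀ (h' : Hom X Z) → h' ≈ h

  IsPullback : ∀ {X Y Z P} (f : Hom X Z) (g : Hom Y Z) (p : Hom P X) (q : Hom P Y)
             → Set (o ⊔ ℓ ⊔ e)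
  IsPullback {X} {Y} {Z} {P} f g p q =
    (f ∘ p ≈ g ∘ q) ×
    (∀ {W} (p' : Hom W X) (q' : Hom W Y) → f ∘ p' ≈ g ∘ q' →
       Σ (Hom W P) λ h → (p ∘ h ≈ p') × (q ∘ h ≈ q') ×
         (∀ (h' : Hom W P) → p ∘ h' ≈ p' → q ∘ h' ≈ q' → h' ≈ h))

  HasPullback : ∀ {X Y Z} (f : Hom X Z) (g : Hom Y Z) → Set (o ⊔ ℓ ⊔ e)
  HasPullback {X} {Y} f g =
    Σ Obj λ P → Σ (Hom P X) λ p → Σ (Hom P Y) λ q → IsPullback f g p q

  IsCoproduct : ∀ {I : Set} (X : I → Obj) (A : Obj) (ι : ∀ i → Hom (X i) A)
              → Set (o ⊔ ℓ ⊔ e)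
  IsCoproduct {I} X A ι =
    ∀ Z (g : ∀ i → Hom (X i) Z) →
      Σ (Hom A Z) λ h → (∀ i → h ∘ ι i ≈ g i) ×
        (∀ (h' : Hom A Z) → (∀ i → h' ∘ ι i ≈ g i) → h' ≈ h)

  IsBinCoproduct : ∀ {A A' S} (i₁ : Hom A S) (i₂ : Hom A' S) → Set (o ⊔ ℓ ⊔ e)
  IsBinCoproduct {A} {A'} {S} i₁ i₂ =
    ∀ Z (g₁ : Hom A Z) (g₂ : Hom A' Z) →
      Σ (Hom S Z) λ h → (h ∘ i₁ ≈ g₁) × (h ∘ i₂ ≈ g₂) ×
        (∀ (h' : Hom S Z) → h' ∘ i₁ ≈ g₁ → h' ∘ i₂ ≈ g₂ → h' ≈ h)

  Summand : ∀ {A B} → Hom A B → Set (o ⊔ ℓ ⊔ e)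
  Summand {A} {B} m = Mono m × (Σ Obj λ A' → Σ (Hom A' B) λ m' → IsBinCoproduct m m')

  _≤ₛ_ : ∀ {A A' B} → Hom A B → Hom A' B → Set (ℓ ⊔ e)
  _≤ₛ_ {A} {A'} a b = Σ (Hom A A') λ k → b ∘ k ≈ a

  IsUnion : ∀ {I : Set} {A : I → Obj} {B U} (m : ∀ i → Hom (A i) B) (u : Hom U B)
          → Set (o ⊔ ℓ ⊔ e)
  IsUnion {I} {A} {B} m u =
    Mono u × (∀ i → m i ≤ₛ u) ×
    (∀ V (v : Hom V B) → Mono v → (∀ i → m i ≤ₛ v) → u ≤ₛ v)

  IsChain : ∀ {A : ℕ → Obj} {B} (m : ∀ n → Hom (A n) B) → Set (ℓ ⊔ e)
  IsChain m = ∀ n → m n ≤ₛ m (ℕ.suc n)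
    where import Data.Nat as ℕ

  HasCountableCoproducts : Set (o ⊔ ℓ ⊔ e)
  HasCountableCoproducts =
    ∀ (κ : CIdx) (X : ⟦ κ ⟧ → Obj) →
      Σ Obj λ A → Σ (∀ i → Hom (X i) A) λ ι → IsCoproduct X A ι

  CountableCoproductsDisjoint : Set (o ⊔ ℓ ⊔ e)
  CountableCoproductsDisjoint =
    ∀ (κ : CIdx) (X : ⟦ κ ⟧ → Obj) A (ι : ∀ i → Hom (X i) A) →
      IsCoproduct X A ι → ∀ i j → i ≢ j →
        HasPullback (ι i) (ι j) ×
        (∀ P (p : Hom P (X i)) (q : Hom P (X j)) → IsPullback (ι i) (ι j) p q → IsInitial P)

  CountableCoproductsUniversal : Set (o ⊔ ℓ ⊔ e)
  CountableCoproductsUniversal =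
    ∀ (κ : CIdx) (X : ⟦ κ ⟧ → Obj) A (ι : ∀ i → Hom (X i) A) →
      IsCoproduct X A ι → ∀ B (f : Hom B A) →
        (∀ i → HasPullback f (ι i)) ×
        (∀ (P : ⟦ κ ⟧ → Obj) (p : ∀ i → Hom (P i) B) (q : ∀ i → Hom (P i) (X i)) →
           (∀ i → IsPullback f (ι i) (p i) (q i)) → IsCoproduct P B p)

  SummandsClosedUnderDisjointUnions : Set (o ⊔ ℓ ⊔ e)
  SummandsClosedUnderDisjointUnions =
    ∀ (κ : CIdx) (A : ⟦ κ ⟧ → Obj) B (a : ∀ i → Hom (A i) B) →
      (∀ i → Summand (a i)) →
      (∀ i j → i ≢ j → ∀ P (p : Hom P (A i)) (q : Hom P (A j)) →
         IsPullback (a i) (a j) p q → IsInitial P) →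
      ∀ S (σ : ∀ i → Hom (A i) S) → IsCoproduct A S σ →
      ∀ (u : Hom S B) → (∀ i → u ∘ σ i ≈ a i) → Summand u

  record Hyperextensive : Set (o ⊔ ℓ ⊔ e) where
    field
      coproducts : HasCountableCoproducts
      disjoint   : CountableCoproductsDisjoint
      universal  : CountableCoproductsUniversal
      sums       : SummandsClosedUnderDisjointUnions

-- Let m n : A n → B be an ω-chain of summands with complements m′ n.  Cut the
-- chain into its successive differences:  D 0 = A 0  and  D (n+1) = A (n+1) ∩ A′ n
-- (a pullback), with inclusions d n : D n → B.  Universality of coproducts splits
-- A (n+1) as (A (n+1) ∩ A n) + D (n+1), so every d n is a summand (a composite of
-- coproduct injections), and disjointness of A n and A′ n makes the d n pairwise
-- disjoint.  Hyperextensivity then says that the induced map s : ∑ D n → B is a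
-- summand; by induction along the splitting it contains every m n, and it is
-- below every upper bound of the d n, hence of the m n: it is the union.  Any
-- other union u is isomorphic to s over B, so it is again a coproduct of the D n
-- with summand pieces d n, hence a summand.  Finally, pulling u back along f,
-- universality decomposes the pullback into pieces each lying below some pullback
-- of an m n, which gives the least-upper-bound property of the pulled-back family.

module Submission where

open import Level using (_⊔_)
open import Data.Nat using (ℕ; zero; suc; _<_; _≤′_; ≤′-refl; ≤′-step; s≤s)
open import Data.Nat.Properties using (<-cmp; ≤⇒≤′)
open import Data.Fin using (Fin) renaming (zero to fz; suc to fs)
open import Data.Product using (Σ; _×_; _,_; proj₁; proj₂)
open import Data.Empty using (⊥-elim)
open import Relation.Binary using (Setoid; IsEquivalence; tri<; tri≈; tri>)
open import Relation.Binary.PropositionalEquality using (_≢_)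
import Relation.Binary.Reasoning.Setoid as SetoidReasoning
open import Defs

-- Dependent elimination for two-element index sets: binary coproducts are the
-- coproducts indexed by Fin 2.
on-two : ∀ {a} {P : Fin 2 → Set a} → P fz → P (fs fz) → ∀ i → P i
on-two x y fz      = x
on-two x y (fs fz) = y

module CategoryFacts {o ℓ e} (𝒞 : Category o ℓ e) where
  open Category 𝒞

  module ≈ {A B} = IsEquivalence (≈-equiv {A} {B})

  hom-setoid : Obj → Obj → Setoid ℓ e
  hom-setoid A B = record { isEquivalence = ≈-equiv {A} {B} }

  open module HomReasoning {A B} = SetoidReasoning (hom-setoid A B) public

  _⟩∘⟨refl : ∀ {A B C} {f f' : Hom B C} {g : Hom A B} → f ≈ f' → f ∘ g ≈ f' ∘ g
  p ⟩∘⟨refl = ∘-resp-≈ p ≈.refl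

  refl⟩∘⟨_ : ∀ {A B C} {f : Hom B C} {g g' : Hom A B} → g ≈ g' → f ∘ g ≈ f ∘ g'
  refl⟩∘⟨ p = ∘-resp-≈ ≈.refl p

  pullʳ : ∀ {A B C D} {f : Hom C D} {g : Hom B C} {h : Hom A B} {k : Hom A C} →
          g ∘ h ≈ k → (f ∘ g) ∘ h ≈ f ∘ k
  pullʳ {f = f} {g} {h} gh≈k = ≈.trans (assoc f g h) (refl⟩∘⟨ gh≈k)

  pullˡ : ∀ {A B C D} {f : Hom C D} {g : Hom B C} {h : Hom A B} {k : Hom B D} →
          f ∘ g ≈ k → f ∘ (g ∘ h) ≈ k ∘ h
  pullˡ {f = f} {g} {h} fg≈k = ≈.trans (≈.sym (assoc f g h)) (fg≈k ⟩∘⟨refl)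

  ≤ₛ-refl : ∀ {A B} (a : Hom A B) → _≤ₛ_ 𝒞 a a
  ≤ₛ-refl a = id , identityʳ a

  ≤ₛ-trans : ∀ {A A' A'' B} {a : Hom A B} {b : Hom A' B} {c : Hom A'' B} →
             _≤ₛ_ 𝒞 a b → _≤ₛ_ 𝒞 b c → _≤ₛ_ 𝒞 a c
  ≤ₛ-trans (k , bk≈a) (k' , ck'≈b) = k' ∘ k , ≈.trans (pullˡ ck'≈b) bk≈a

  ≤ₛ-resp : ∀ {A A' B} {a a' : Hom A B} {b : Hom A' B} →
            a ≈ a' → _≤ₛ_ 𝒞 a b → _≤ₛ_ 𝒞 a' b
  ≤ₛ-resp a≈a' (k , bk≈a) = k , ≈.trans bk≈a a≈a'

  ≤ₛ-∘ : ∀ {Z A A' B} {a : Hom A B} {b : Hom A' B} →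
         _≤ₛ_ 𝒞 a b → (x : Hom Z A) → _≤ₛ_ 𝒞 (a ∘ x) b
  ≤ₛ-∘ {b = b} (k , bk≈a) x = k ∘ x , ≈.trans (≈.sym (assoc b k x)) (bk≈a ⟩∘⟨refl)

  Mono-∘ : ∀ {X Y Z} {f : Hom Y Z} {g : Hom X Y} → Mono 𝒞 f → Mono 𝒞 g → Mono 𝒞 (f ∘ g)
  Mono-∘ {f = f} {g} f-mono g-mono x y fgx≈fgy =
    g-mono x y (f-mono (g ∘ x) (g ∘ y) (begin
      f ∘ (g ∘ x)   ≈⟨ assoc f g x ⟨
      (f ∘ g) ∘ x   ≈⟨ fgx≈fgy ⟩
      (f ∘ g) ∘ y   ≈⟨ assoc f g y ⟩
      f ∘ (g ∘ y)   ∎))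

  mutually-below-iso : ∀ {U V B} {u : Hom U B} {v : Hom V B} → Mono 𝒞 u → Mono 𝒞 v →
    ((k , _) : _≤ₛ_ 𝒞 u v) ((j , _) : _≤ₛ_ 𝒞 v u) → (k ∘ j ≈ id) × (j ∘ k ≈ id)
  mutually-below-iso {B = B} {u = u} {v} u-mono v-mono (k , vk≈u) (j , uj≈v) =
    v-mono (k ∘ j) id (round-trip vk≈u uj≈v) , u-mono (j ∘ k) id (round-trip uj≈v vk≈u)
    where
    round-trip : ∀ {X Y} {x : Hom X B} {y : Hom Y B} {a : Hom X Y} {b : Hom Y X} →
                 y ∘ a ≈ x → x ∘ b ≈ y → y ∘ (a ∘ b) ≈ y ∘ id
    round-trip {x = x} {y} {a} {b} ya≈x xb≈y = begin
      y ∘ (a ∘ b)   ≈⟨ pullˡ ya≈x ⟩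
      x ∘ b         ≈⟨ xb≈y ⟩
      y             ≈⟨ identityʳ y ⟨
      y ∘ id        ∎

  module Coproduct {I : Set} {X : I → Obj} {S} {σ : ∀ i → Hom (X i) S}
                   (c : IsCoproduct 𝒞 X S σ) where

    copair : ∀ {Z} → (∀ i → Hom (X i) Z) → Hom S Z
    copair g = proj₁ (c _ g)

    copair-β : ∀ {Z} (g : ∀ i → Hom (X i) Z) i → copair g ∘ σ i ≈ g i
    copair-β g = proj₁ (proj₂ (c _ g))

    jointly-epic : ∀ {Z} (h h' : Hom S Z) → (∀ i → h ∘ σ i ≈ h' ∘ σ i) → h ≈ h'
    jointly-epic {Z} h h' h≈h' =
      ≈.trans (proj₂ (proj₂ (c Z g)) h h≈h') (≈.sym (proj₂ (proj₂ (c Z g)) h' λ i → ≈.refl))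
      where
      g : ∀ i → Hom (X i) Z
      g i = h' ∘ σ i

    below-if-pieces-below : ∀ {B V} (u : Hom S B) {v : Hom V B} →
      (∀ i → _≤ₛ_ 𝒞 (u ∘ σ i) v) → _≤ₛ_ 𝒞 u v
    below-if-pieces-below {V = V} u {v} pieces =
      copair k , jointly-epic (v ∘ copair k) u λ i → ≈.trans (pullʳ (copair-β k i)) (proj₂ (pieces i))
      where
      k : ∀ i → Hom (X i) V
      k i = proj₁ (pieces i)

    along-iso : ∀ {U} (j : Hom S U) (k : Hom U S) → k ∘ j ≈ id → j ∘ k ≈ id →
                IsCoproduct 𝒞 X U (λ i → j ∘ σ i)
    along-iso j k kj≈id jk≈id Z g = copair g ∘ k , β , η
      where
      β : ∀ i → (copair g ∘ k) ∘ (j ∘ σ i) ≈ g i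
      β i = begin
        (copair g ∘ k) ∘ (j ∘ σ i)   ≈⟨ pullʳ (pullˡ kj≈id) ⟩
        copair g ∘ (id ∘ σ i)        ≈⟨ refl⟩∘⟨ identityˡ (σ i) ⟩
        copair g ∘ σ i               ≈⟨ copair-β g i ⟩
        g i                          ∎
      η : ∀ h → (∀ i → h ∘ (j ∘ σ i) ≈ g i) → h ≈ copair g ∘ k
      η h hjσ≈g = begin
        h                  ≈⟨ identityʳ h ⟨
        h ∘ id             ≈⟨ refl⟩∘⟨ jk≈id ⟨
        h ∘ (j ∘ k)        ≈⟨ assoc h j k ⟨
        (h ∘ j) ∘ k        ≈⟨ hj≈copair ⟩∘⟨refl ⟩
        copair g ∘ k       ∎
        where
        hj≈copair : h ∘ j ≈ copair g
        hj≈copair = jointly-epic (h ∘ j) (copair g) λ i →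
          ≈.trans (pullʳ ≈.refl) (≈.trans (hjσ≈g i) (≈.sym (copair-β g i)))

  bin→co : ∀ {X Y S} {i₁ : Hom X S} {i₂ : Hom Y S} → IsBinCoproduct 𝒞 i₁ i₂ →
           IsCoproduct 𝒞 (on-two X Y) S (on-two i₁ i₂)
  bin→co c Z g with c Z (g fz) (g (fs fz))
  ... | h , β₁ , β₂ , η = h , on-two β₁ β₂ , λ h' β' → η h' (β' fz) (β' (fs fz))

  co→bin : ∀ {X : Fin 2 → Obj} {S} {ι : ∀ i → Hom (X i) S} → IsCoproduct 𝒞 X S ι →
           IsBinCoproduct 𝒞 (ι fz) (ι (fs fz))
  co→bin c Z g₁ g₂ with c Z (on-two g₁ g₂)
  ... | h , β , η = h , β fz , β (fs fz) , λ h' β₁ β₂ → η h' (on-two β₁ β₂)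

  bin-swap : ∀ {X Y S} {i₁ : Hom X S} {i₂ : Hom Y S} →
             IsBinCoproduct 𝒞 i₁ i₂ → IsBinCoproduct 𝒞 i₂ i₁
  bin-swap c Z g₁ g₂ with c Z g₂ g₁
  ... | h , β₁ , β₂ , η = h , β₂ , β₁ , λ h' β₁' β₂' → η h' β₂' β₁'

  module BinCoproduct {X Y S} {i₁ : Hom X S} {i₂ : Hom Y S}
                      (c : IsBinCoproduct 𝒞 i₁ i₂) where

    [_,_] : ∀ {Z} → Hom X Z → Hom Y Z → Hom S Z
    [ g₁ , g₂ ] = proj₁ (c _ g₁ g₂)

    inject₁ : ∀ {Z} {g₁ : Hom X Z} {g₂ : Hom Y Z} → [ g₁ , g₂ ] ∘ i₁ ≈ g₁
    inject₁ = proj₁ (proj₂ (c _ _ _))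

    inject₂ : ∀ {Z} {g₁ : Hom X Z} {g₂ : Hom Y Z} → [ g₁ , g₂ ] ∘ i₂ ≈ g₂
    inject₂ = proj₁ (proj₂ (proj₂ (c _ _ _)))

    jointly-epic₂ : ∀ {Z} (h h' : Hom S Z) → h ∘ i₁ ≈ h' ∘ i₁ → h ∘ i₂ ≈ h' ∘ i₂ → h ≈ h'
    jointly-epic₂ h h' e₁ e₂ = Coproduct.jointly-epic (bin→co c) h h' (on-two e₁ e₂)

  -- summands compose: if Y = X + X′ and Z = Y + Y′ then Z = X + (X′ + Y′)
  summand-∘ : HasCountableCoproducts 𝒞 → ∀ {X Y Z} {i : Hom X Y} {j : Hom Y Z} →
              Summand 𝒞 i → Summand 𝒞 j → Summand 𝒞 (j ∘ i)
  summand-∘ coproducts {X} {Y} {Z} {i} {j} (i-mono , X′ , i′ , i⊕i′) (j-mono , Y′ , j′ , j⊕j′) =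
    Mono-∘ j-mono i-mono , W , k , ji⊕k
    where
    module I = BinCoproduct i⊕i′
    module J = BinCoproduct j⊕j′
    W : Obj
    W = proj₁ (coproducts (fin 2) (on-two X′ Y′))
    c : ∀ i → Hom (on-two X′ Y′ i) W
    c = proj₁ (proj₂ (coproducts (fin 2) (on-two X′ Y′)))
    c₁ : Hom X′ W
    c₁ = c fz
    c₂ : Hom Y′ W
    c₂ = c (fs fz)
    c₁⊕c₂ : IsBinCoproduct 𝒞 c₁ c₂
    c₁⊕c₂ = co→bin (proj₂ (proj₂ (coproducts (fin 2) (on-two X′ Y′))))
    module W = BinCoproduct c₁⊕c₂
    k : Hom W Z
    k = W.[ j ∘ i′ , j′ ]

    ji⊕k : IsBinCoproduct 𝒞 (j ∘ i) k
    ji⊕k T g₁ g₂ = h , β₁ , β₂ , η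
      where
      hY : Hom Y T
      hY = I.[ g₁ , g₂ ∘ c₁ ]
      h : Hom Z T
      h = J.[ hY , g₂ ∘ c₂ ]
      β₁ : h ∘ (j ∘ i) ≈ g₁
      β₁ = ≈.trans (pullˡ J.inject₁) I.inject₁
      β₂ : h ∘ k ≈ g₂
      β₂ = W.jointly-epic₂ (h ∘ k) g₂
        (≈.trans (pullʳ W.inject₁) (≈.trans (pullˡ J.inject₁) I.inject₂))
        (≈.trans (pullʳ W.inject₂) J.inject₂)
      η : ∀ h' → h' ∘ (j ∘ i) ≈ g₁ → h' ∘ k ≈ g₂ → h' ≈ h
      η h' h'ji≈g₁ h'k≈g₂ = J.jointly-epic₂ h' h (≈.trans h'j≈hY (≈.sym J.inject₁)) (begin
        h' ∘ j′          ≈⟨ refl⟩∘⟨ W.inject₂ ⟨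
        h' ∘ (k ∘ c₂)    ≈⟨ assoc h' k c₂ ⟨
        (h' ∘ k) ∘ c₂    ≈⟨ h'k≈g₂ ⟩∘⟨refl ⟩
        g₂ ∘ c₂          ≈⟨ J.inject₂ ⟨
        h ∘ j′           ∎)
        where
        h'j≈hY : h' ∘ j ≈ hY
        h'j≈hY = I.jointly-epic₂ (h' ∘ j) hY
          (≈.trans (pullʳ ≈.refl) (≈.trans h'ji≈g₁ (≈.sym I.inject₁))) (begin
            (h' ∘ j) ∘ i′    ≈⟨ pullʳ (≈.sym W.inject₁) ⟩
            h' ∘ (k ∘ c₁)    ≈⟨ assoc h' k c₁ ⟨
            (h' ∘ k) ∘ c₁    ≈⟨ h'k≈g₂ ⟩∘⟨refl ⟩
            g₂ ∘ c₁          ≈⟨ I.inject₂ ⟨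
            hY ∘ i′          ∎)

  record Pullback {X Y Z} (f : Hom X Z) (g : Hom Y Z) : Set (o ⊔ ℓ ⊔ e) where
    field
      P          : Obj
      p          : Hom P X
      q          : Hom P Y
      isPullback : IsPullback 𝒞 f g p q

  pullback : ∀ {X Y Z} {f : Hom X Z} {g : Hom Y Z} → HasPullback 𝒞 f g → Pullback f g
  pullback (P , p , q , isPullback) = record { P = P ; p = p ; q = q ; isPullback = isPullback }

  pullback-comm : ∀ {X Y Z P W} {f : Hom X Z} {g : Hom Y Z} {p : Hom P X} {q : Hom P Y} →
    IsPullback 𝒞 f g p q → (x : Hom W P) → f ∘ (p ∘ x) ≈ g ∘ (q ∘ x)
  pullback-comm {f = f} {g} {p} {q} (fp≈gq , _) x = begin
    f ∘ (p ∘ x)   ≈⟨ pullˡ fp≈gq ⟩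
    (g ∘ q) ∘ x   ≈⟨ assoc g q x ⟩
    g ∘ (q ∘ x)   ∎

  pullback-factor : ∀ {X Y Z P W} {f : Hom X Z} {g : Hom Y Z} {p : Hom P X} {q : Hom P Y} →
    IsPullback 𝒞 f g p q → {x : Hom W X} {y : Hom W Y} → f ∘ x ≈ g ∘ y → _≤ₛ_ 𝒞 x p
  pullback-factor (_ , universal) {x} {y} fx≈gy with universal x y fx≈gy
  ... | h , ph≈x , _ = h , ph≈x

  pullback-mono : ∀ {X Y Z P} {f : Hom X Z} {g : Hom Y Z} {p : Hom P X} {q : Hom P Y} →
    IsPullback 𝒞 f g p q → Mono 𝒞 g → Mono 𝒞 p
  pullback-mono {f = f} {g} {p} {q} pb@(_ , universal) g-mono x y px≈py
    with universal (p ∘ x) (q ∘ x) (pullback-comm pb x)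
  ... | _ , _ , _ , unique = ≈.trans (unique x ≈.refl ≈.refl) (≈.sym (unique y (≈.sym px≈py) (≈.sym qx≈qy)))
    where
    qx≈qy : q ∘ x ≈ q ∘ y
    qx≈qy = g-mono (q ∘ x) (q ∘ y) (begin
      g ∘ (q ∘ x)   ≈⟨ pullback-comm pb x ⟨
      f ∘ (p ∘ x)   ≈⟨ refl⟩∘⟨ px≈py ⟩
      f ∘ (p ∘ y)   ≈⟨ pullback-comm pb y ⟩
      g ∘ (q ∘ y)   ∎)

module ExtensiveFacts {o ℓ e} (𝒞 : Category o ℓ e)
                      (universal : CountableCoproductsUniversal 𝒞)
                      (disjoint  : CountableCoproductsDisjoint 𝒞) where
  open Category 𝒞
  open CategoryFacts 𝒞

  -- initial objects are strict: whatever maps into one is itself initial,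
  -- because pulling back the empty coproduct gives the empty coproduct
  initial-strict : ∀ {P R} → IsInitial 𝒞 R → Hom P R → IsInitial 𝒞 P
  initial-strict {P} {R} R-initial f Z
    with proj₂ (universal (fin 0) (λ ()) R (λ ()) R-empty P f) (λ ()) (λ ()) (λ ()) (λ ()) Z (λ ())
    where
    R-empty : IsCoproduct 𝒞 (λ ()) R (λ ())
    R-empty Z _ = proj₁ (R-initial Z) , (λ ()) , λ h _ → proj₂ (R-initial Z) h
  ... | h , _ , unique = h , λ h' → unique h' (λ ())

  module _ {X Y S} {i₁ : Hom X S} {i₂ : Hom Y S} (c : IsBinCoproduct 𝒞 i₁ i₂) where

    injection-pullbacks : ∀ {C} (f : Hom C S) → HasPullback 𝒞 f i₁ × HasPullback 𝒞 f i₂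
    injection-pullbacks {C} f = pullbacks fz , pullbacks (fs fz)
      where
      ι : ∀ i → Hom (on-two X Y i) S
      ι = on-two i₁ i₂
      pullbacks : ∀ i → HasPullback 𝒞 f (ι i)
      pullbacks = proj₁ (universal (fin 2) (on-two X Y) S ι (bin→co c) C f)

    binary-universal : ∀ {C P₁ P₂} (f : Hom C S)
      {p₁ : Hom P₁ C} {q₁ : Hom P₁ X} {p₂ : Hom P₂ C} {q₂ : Hom P₂ Y} →
      IsPullback 𝒞 f i₁ p₁ q₁ → IsPullback 𝒞 f i₂ p₂ q₂ → IsBinCoproduct 𝒞 p₁ p₂
    binary-universal {C} {P₁} {P₂} f {p₁} {q₁} {p₂} {q₂} pb₁ pb₂ =
      co→bin (proj₂ (universal (fin 2) (on-two X Y) S (on-two i₁ i₂) (bin→co c) C f)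
                    (on-two P₁ P₂) (on-two p₁ p₂) (on-two q₁ q₂) (on-two pb₁ pb₂))

    binary-disjoint : ∀ P (p : Hom P X) (q : Hom P Y) → IsPullback 𝒞 i₁ i₂ p q → IsInitial 𝒞 P
    binary-disjoint = proj₂ (disjoint (fin 2) (on-two X Y) S (on-two i₁ i₂) (bin→co c) fz (fs fz) λ ())

    -- coproduct injections are monic: universality splits X along the kernel
    -- pair p, q : P → X of i₁ as P + (X ∩ Y) with X ∩ Y initial, so p has a
    -- retraction r; the diagonal δ then equals r, which forces p ≈ q
    injection-mono : Mono 𝒞 i₁
    injection-mono {Z} x y i₁x≈i₁y = begin
      x         ≈⟨ ph≈x ⟨
      p ∘ h     ≈⟨ p≈q ⟩∘⟨refl ⟩
      q ∘ h     ≈⟨ qh≈y ⟩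
      y         ∎
      where
      kernel-pair : Pullback i₁ i₁
      kernel-pair = pullback (proj₁ (injection-pullbacks i₁))
      intersection : Pullback i₁ i₂
      intersection = pullback (proj₂ (injection-pullbacks i₁))
      open Pullback kernel-pair
      open Pullback intersection using () renaming (P to X∩Y; p to p₂; q to q₂; isPullback to isPullback₂)

      X∩Y-initial : IsInitial 𝒞 X∩Y
      X∩Y-initial = binary-disjoint X∩Y p₂ q₂ isPullback₂

      open BinCoproduct (binary-universal i₁ isPullback isPullback₂)
      r : Hom X P
      r = [ id , proj₁ (X∩Y-initial P) ]

      δ : Hom X P
      δ = proj₁ (proj₂ isPullback id id ≈.refl)
      pδ≈id : p ∘ δ ≈ id
      pδ≈id = proj₁ (proj₂ (proj₂ isPullback id id ≈.refl))
      qδ≈id : q ∘ δ ≈ id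
      qδ≈id = proj₁ (proj₂ (proj₂ (proj₂ isPullback id id ≈.refl)))

      δ≈r : δ ≈ r
      δ≈r = begin
        δ             ≈⟨ identityˡ δ ⟨
        id ∘ δ        ≈⟨ inject₁ ⟩∘⟨refl ⟨
        (r ∘ p) ∘ δ   ≈⟨ pullʳ pδ≈id ⟩
        r ∘ id        ≈⟨ identityʳ r ⟩
        r             ∎

      p≈q : p ≈ q
      p≈q = begin
        p             ≈⟨ identityˡ p ⟨
        id ∘ p        ≈⟨ qδ≈id ⟩∘⟨refl ⟨
        (q ∘ δ) ∘ p   ≈⟨ pullʳ (≈.trans (δ≈r ⟩∘⟨refl) inject₁) ⟩
        q ∘ id        ≈⟨ identityʳ q ⟩
        q             ∎

      h : Hom Z P
      h = proj₁ (proj₂ isPullback x y i₁x≈i₁y)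
      ph≈x : p ∘ h ≈ x
      ph≈x = proj₁ (proj₂ (proj₂ isPullback x y i₁x≈i₁y))
      qh≈y : q ∘ h ≈ y
      qh≈y = proj₁ (proj₂ (proj₂ (proj₂ isPullback x y i₁x≈i₁y)))

    injection-summand : Summand 𝒞 i₁
    injection-summand = injection-mono , Y , i₂ , c

    below-disjoint : ∀ {A A' P} {a : Hom A S} {b : Hom A' S} →
      _≤ₛ_ 𝒞 a i₁ → _≤ₛ_ 𝒞 b i₂ →
      (x : Hom P A) (y : Hom P A') → a ∘ x ≈ b ∘ y → IsInitial 𝒞 P
    below-disjoint {a = a} {b} (ka , i₁ka≈a) (kb , i₂kb≈b) x y ax≈by =
      initial-strict (binary-disjoint X∩Y p q isPullback) (proj₁ (pullback-factor isPullback commutes))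
      where
      open Pullback (pullback (proj₂ (injection-pullbacks i₁))) renaming (P to X∩Y)
      commutes : i₁ ∘ (ka ∘ x) ≈ i₂ ∘ (kb ∘ y)
      commutes = begin
        i₁ ∘ (ka ∘ x)   ≈⟨ pullˡ i₁ka≈a ⟩
        a ∘ x           ≈⟨ ax≈by ⟩
        b ∘ y           ≈⟨ pullˡ i₂kb≈b ⟨
        i₂ ∘ (kb ∘ y)   ∎

  summand-pullback : ∀ {A B} {u : Hom A B} → Summand 𝒞 u → ∀ {C} (f : Hom C B) → HasPullback 𝒞 f u
  summand-pullback (_ , _ , _ , u⊕u′) f = proj₁ (injection-pullbacks u⊕u′ f)

module ChainUnion {o ℓ e} (𝒞 : Category o ℓ e) (H : Hyperextensive 𝒞)
                  (A : ℕ → Category.Obj 𝒞) (B : Category.Obj 𝒞)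
                  (m : ∀ n → Category.Hom 𝒞 (A n) B)
                  (m-summand : ∀ n → Summand 𝒞 (m n)) (chain : IsChain 𝒞 m) where
  open Category 𝒞
  open Hyperextensive H
  open CategoryFacts 𝒞
  open ExtensiveFacts 𝒞 universal disjoint
  open Pullback

  A′ : ℕ → Obj
  A′ n = proj₁ (proj₂ (m-summand n))

  m′ : ∀ n → Hom (A′ n) B
  m′ n = proj₁ (proj₂ (proj₂ (m-summand n)))

  m⊕m′ : ∀ n → IsBinCoproduct 𝒞 (m n) (m′ n)
  m⊕m′ n = proj₂ (proj₂ (proj₂ (m-summand n)))

  chain-≤ : ∀ {i n} → i ≤′ n → _≤ₛ_ 𝒞 (m i) (m n)
  chain-≤ {i} ≤′-refl          = ≤ₛ-refl (m i)
  chain-≤ (≤′-step {n} i≤′n) = ≤ₛ-trans (chain-≤ i≤′n) (chain n)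

  new : ∀ n → Pullback (m (suc n)) (m′ n)
  new n = pullback (proj₂ (injection-pullbacks (m⊕m′ n) (m (suc n))))

  old : ∀ n → Pullback (m (suc n)) (m n)
  old n = pullback (proj₁ (injection-pullbacks (m⊕m′ n) (m (suc n))))

  A-split : ∀ n → IsBinCoproduct 𝒞 (p (old n)) (p (new n))
  A-split n = binary-universal (m⊕m′ n) (m (suc n)) (isPullback (old n)) (isPullback (new n))

  D : ℕ → Obj
  D zero    = A zero
  D (suc n) = P (new n)

  d : ∀ n → Hom (D n) B
  d zero    = m zero
  d (suc n) = m (suc n) ∘ p (new n)

  d≤m : ∀ n → _≤ₛ_ 𝒞 (d n) (m n)
  d≤m zero    = ≤ₛ-refl (m zero)
  d≤m (suc n) = p (new n) , ≈.refl

  d-summand : ∀ n → Summand 𝒞 (d n)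
  d-summand zero    = m-summand zero
  d-summand (suc n) =
    summand-∘ coproducts (injection-summand (bin-swap (A-split n))) (m-summand (suc n))

  -- for i < n+1, D i lies in A n while D (n+1) lies in its complement A′ n
  d-disjoint-< : ∀ {i j} → i < j → ∀ {Z} (x : Hom Z (D i)) (y : Hom Z (D j)) →
                 d i ∘ x ≈ d j ∘ y → IsInitial 𝒞 Z
  d-disjoint-< {i} {suc n} (s≤s i≤n) =
    below-disjoint (m⊕m′ n) (≤ₛ-trans (d≤m i) (chain-≤ (≤⇒≤′ i≤n)))
                   (q (new n) , ≈.sym (proj₁ (isPullback (new n))))

  d-disjoint : ∀ i j → i ≢ j → ∀ Z (x : Hom Z (D i)) (y : Hom Z (D j)) →
               IsPullback 𝒞 (d i) (d j) x y → IsInitial 𝒞 Z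
  d-disjoint i j i≢j Z x y (dx≈dy , _) with <-cmp i j
  ... | tri< i<j _ _ = d-disjoint-< i<j x y dx≈dy
  ... | tri≈ _ i≡j _ = ⊥-elim (i≢j i≡j)
  ... | tri> _ _ j<i = d-disjoint-< j<i y x (≈.sym dx≈dy)

  D-coproduct-summand : ∀ {U} {w : ∀ n → Hom (D n) U} → IsCoproduct 𝒞 D U w →
                        (u : Hom U B) → (∀ n → u ∘ w n ≈ d n) → Summand 𝒞 u
  D-coproduct-summand {U} {w} = sums omega D B d d-summand d-disjoint U w

  S : Obj
  S = proj₁ (coproducts omega D)
  σ : ∀ n → Hom (D n) S
  σ = proj₁ (proj₂ (coproducts omega D))
  σ-coproduct : IsCoproduct 𝒞 D S σ
  σ-coproduct = proj₂ (proj₂ (coproducts omega D))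

  s : Hom S B
  s = Coproduct.copair σ-coproduct d

  s∘σ≈d : ∀ n → s ∘ σ n ≈ d n
  s∘σ≈d = Coproduct.copair-β σ-coproduct d

  s-summand : Summand 𝒞 s
  s-summand = D-coproduct-summand σ-coproduct s s∘σ≈d

  m≤s : ∀ n → _≤ₛ_ 𝒞 (m n) s
  m≤s zero    = σ zero , s∘σ≈d zero
  m≤s (suc n) = Coproduct.below-if-pieces-below (bin→co (A-split n)) (m (suc n)) (on-two old≤s new≤s)
    where
    old≤s : _≤ₛ_ 𝒞 (m (suc n) ∘ p (old n)) s
    old≤s = ≤ₛ-resp (≈.sym (proj₁ (isPullback (old n)))) (≤ₛ-∘ (m≤s n) (q (old n)))
    new≤s : _≤ₛ_ 𝒞 (m (suc n) ∘ p (new n)) s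
    new≤s = σ (suc n) , s∘σ≈d (suc n)

  s-union : IsUnion 𝒞 m s
  s-union = proj₁ s-summand , m≤s , λ V v _ m≤v →
    Coproduct.below-if-pieces-below σ-coproduct s λ n →
      ≤ₛ-resp (≈.sym (s∘σ≈d n)) (≤ₛ-trans (d≤m n) (m≤v n))

  -- any union u is isomorphic to s over B, hence again a coproduct of the D n
  union-coproduct : ∀ {U} {u : Hom U B} → IsUnion 𝒞 m u →
    Σ (∀ n → Hom (D n) U) λ w → IsCoproduct 𝒞 D U w × (∀ n → u ∘ w n ≈ d n)
  union-coproduct {U} {u} (u-mono , m≤u , u-least) =
    (λ n → j ∘ σ n) , Coproduct.along-iso σ-coproduct j k kj≈id jk≈id , λ n → ≈.trans (pullˡ uj≈s) (s∘σ≈d n)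
    where
    s≤u : _≤ₛ_ 𝒞 s u
    s≤u = proj₂ (proj₂ s-union) U u u-mono m≤u
    u≤s : _≤ₛ_ 𝒞 u s
    u≤s = u-least S s (proj₁ s-summand) m≤s
    j : Hom S U
    j = proj₁ s≤u
    uj≈s : u ∘ j ≈ s
    uj≈s = proj₂ s≤u
    k : Hom U S
    k = proj₁ u≤s
    jk≈id : j ∘ k ≈ id
    jk≈id = proj₁ (mutually-below-iso (proj₁ s-summand) u-mono s≤u u≤s)
    kj≈id : k ∘ j ≈ id
    kj≈id = proj₂ (mutually-below-iso (proj₁ s-summand) u-mono s≤u u≤s)

  union-summand : ∀ {U} {u : Hom U B} → IsUnion 𝒞 m u → Summand 𝒞 u
  union-summand {u = u} u-union with union-coproduct u-union
  ... | w , w-coproduct , uw≈d = D-coproduct-summand w-coproduct u uw≈d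

  -- pulling back along f: each pₙ lies below p′ since m n ≤ u, and p′ is least
  -- because universality splits Q into the pullbacks of the pieces D n → U,
  -- each of which factors through some pₙ
  union-pullback-union : ∀ {U} {u : Hom U B} → IsUnion 𝒞 m u → ∀ {C} (f : Hom C B)
    {P : ℕ → Obj} {p : ∀ n → Hom (P n) C} {q : ∀ n → Hom (P n) (A n)}
    {Q : Obj} {p′ : Hom Q C} {q′ : Hom Q U} →
    (∀ n → IsPullback 𝒞 f (m n) (p n) (q n)) → IsPullback 𝒞 f u p′ q′ →
    IsUnion 𝒞 p p′
  union-pullback-union {U} {u} u-union@(u-mono , m≤u , _) {C} f {p = p} {Q = Q} {p′} {q′} pbₙ pb =
    pullback-mono pb u-mono , pₙ≤p′ , p′-least
    where
    pₙ≤p′ : ∀ n → _≤ₛ_ 𝒞 (p n) p′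
    pₙ≤p′ n = pullback-factor pb (≈.trans (proj₁ (pbₙ n)) (≈.sym (pullˡ (proj₂ (m≤u n)))))

    p′-least : ∀ V (v : Hom V C) → Mono 𝒞 v → (∀ n → _≤ₛ_ 𝒞 (p n) v) → _≤ₛ_ 𝒞 p′ v
    p′-least V v _ p≤v with union-coproduct u-union
    ... | w , w-coproduct , uw≈d =
      Coproduct.below-if-pieces-below Q-coproduct p′ λ n →
        ≤ₛ-trans (pullback-factor (pbₙ n) (piece-commutes n)) (p≤v n)
      where
      Qₙ : ∀ n → Pullback q′ (w n)
      Qₙ n = pullback (proj₁ (universal omega D U w w-coproduct Q q′) n)
      Q-coproduct : IsCoproduct 𝒞 (λ n → Pullback.P (Qₙ n)) Q (λ n → Pullback.p (Qₙ n))
      Q-coproduct = proj₂ (universal omega D U w w-coproduct Q q′) _ _ _ (λ n → isPullback (Qₙ n))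

      piece-commutes : ∀ n → f ∘ (p′ ∘ Pullback.p (Qₙ n)) ≈ m n ∘ (proj₁ (d≤m n) ∘ Pullback.q (Qₙ n))
      piece-commutes n = begin
        f ∘ (p′ ∘ a)            ≈⟨ pullback-comm pb a ⟩
        u ∘ (q′ ∘ a)            ≈⟨ refl⟩∘⟨ proj₁ (isPullback (Qₙ n)) ⟩
        u ∘ (w n ∘ b)           ≈⟨ pullˡ (uw≈d n) ⟩
        d n ∘ b                 ≈⟨ pullˡ (proj₂ (d≤m n)) ⟨
        m n ∘ (proj₁ (d≤m n) ∘ b) ∎
        where
        a : Hom (Pullback.P (Qₙ n)) Q
        a = Pullback.p (Qₙ n)
        b : Hom (Pullback.P (Qₙ n)) (D n)
        b = Pullback.q (Qₙ n)

lemma6p9 : ∀ {o ℓ e} (𝒞 : Category o ℓ e) → Hyperextensive 𝒞 →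
    let open Category 𝒞 in
    ∀ (A : ℕ → Obj) (B : Obj) (m : ∀ n → Hom (A n) B) →
    (∀ n → Summand 𝒞 (m n)) → IsChain 𝒞 m →
    (Σ Obj λ U → Σ (Hom U B) λ u → IsUnion 𝒞 m u) ×
    (∀ U (u : Hom U B) → IsUnion 𝒞 m u → Summand 𝒞 u) ×
    (∀ U (u : Hom U B) → IsUnion 𝒞 m u → ∀ C (f : Hom C B) →
    (∀ n → HasPullback 𝒞 f (m n)) × HasPullback 𝒞 f u ×
    (∀ (P : ℕ → Obj) (p : ∀ n → Hom (P n) C) (q : ∀ n → Hom (P n) (A n))
    (Q : Obj) (p' : Hom Q C) (q' : Hom Q U) →
    (∀ n → IsPullback 𝒞 f (m n) (p n) (q n)) → IsPullback 𝒞 f u p' q' →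
    IsUnion 𝒞 p p'))
lemma6p9 𝒞 H A B m m-summand chain =
  (S , s , s-union) ,
  (λ U u → union-summand) ,
  λ U u u-union C f →
    (λ n → summand-pullback (m-summand n) f) ,
    summand-pullback (union-summand u-union) f ,
    λ P p q Q p′ q′ → union-pullback-union u-union f
  where
  open Hyperextensive H using (universal; disjoint)
  open ExtensiveFacts 𝒞 universal disjoint using (summand-pullback)
  open ChainUnion 𝒞 H A B m m-summand chain
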